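{- Let $\mathcal{B}_1,\mathcal{B}_2$ be bicategories, let $L\dashv R$ be a biadjunction with $L:\mathcal{B}_1\to\mathcal{B}_2$, let $\mathcal{D}_1,\mathcal{D}_2$ be displayed bicategories over $\mathcal{B}_1,\mathcal{B}_2$, and let $\bar L$ be a displayed pseudofunctor from $\mathcal{D}_1$ to $\mathcal{D}_2$ over $L$ which is a displayed left biadjoint pseudofunctor. Then the total pseudofunctor $\int\bar L:\int\mathcal{D}_1\to\int\mathcal{D}_2$ is a left biadjoint pseudofunctor.
   Context: Displayed bicategories, displayed pseudofunctors, displayed pseudotransformations, displayed invertible 2-cells and displayed invertible modifications are as in Ahrens et al., "Bicategories in univalent foundations": a displayed bicategory $\mathcal{D}$ over $\mathcal{B}$ gives types of objects over each object of $\mathcal{B}$, 1-cells over 1-cells, sets of 2-cells over 2-cells, with displayed identities, compositions and whiskerings; its total bicategory $\int\mathcal{D}$ has as objects pairs $(x,\bar x)$, and similarly for 1- and 2-cells. A displayed pseudofunctor $\bar F$ over $F$ has a total pseudofunctor $\int\bar F$ acting by pairing (likewise for displayed pseudotransformations and invertible modifications). A biadjunction $L\dashv R$ consists of pseudofunctors $L:\mathcal{B}_1\to\mathcal{B}_2$, $R:\mathcal{B}_2\to\mathcal{B}_1$, pseudotransformations $\eta:\mathrm{id}\Rightarrow L\cdot R$, $\varepsilon:R\cdot L\Rightarrow\mathrm{id}$ (diagrammatic composition) and invertible modifications $\tau_1:\rho^{ -1}\bullet R\vartriangleleft\eta\bullet\alpha\bullet\varepsilon\vartriangleright R\bullet\lambda\Rrightarrow\mathrm{id}(R)$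 and $\tau_2:\lambda^{ -1}\bullet\eta\vartriangleright L\bullet\alpha^{ -1}\bullet L\vartriangleleft\varepsilon\bullet\rho\Rrightarrow\mathrm{id}(L)$; $L$ is a left biadjoint if such data exist. Given $L\dashv R$ with data $\eta,\varepsilon,\tau_1,\tau_2$, a displayed pseudofunctor $\bar L$ over $L$ is a displayed left biadjoint pseudofunctor if there are a displayed pseudofunctor $\bar R$ over $R$, displayed pseudotransformations $\bar\eta:\mathrm{id}\Rightarrow\bar L\cdot\bar R$ over $\eta$ and $\bar\varepsilon:\bar R\cdot\bar L\Rightarrow\mathrm{id}$ over $\varepsilon$, and displayed invertible modifications over $\tau_1$ and $\tau_2$ between the displayed analogues of the same composites. -}

module Defs where

-- Bicategories, displayed bicategories, pseudofunctors, pseudotransformations,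
-- modifications and biadjunctions, following Ahrens et al.,
-- "Bicategories in univalent foundations" (and UniMath's conventions):
-- composition of 1-cells and of 2-cells is written in diagrammatic order.

open import Level using (Level; _⊔_) renaming (suc to lsuc)
open import Relation.Binary.PropositionalEquality using (_≡_; refl; subst)
open import Data.Product using (Σ; _,_; proj₁; proj₂)

Σ-≡ : ∀ {a b} {A : Set a} {P : A → Set b} {x y : A} {u : P x} {v : P y}
      (p : x ≡ y) → subst P p u ≡ v → _≡_ {A = Σ A P} (x , u) (y , v)
Σ-≡ refl refl = refl

record Bicategory (o h t : Level) : Set (lsuc (o ⊔ h ⊔ t)) where
  infixl 5 _•_
  field
    Ob  : Set o
    _⟶_ : Ob → Ob → Set h
    _⇒_ : ∀ {a b} → a ⟶ b → a ⟶ b → Set t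
    id₁ : ∀ {a} → a ⟶ a
    _·_ : ∀ {a b c} → a ⟶ b → b ⟶ c → a ⟶ c
    id₂ : ∀ {a b} {f : a ⟶ b} → f ⇒ f
    _•_ : ∀ {a b} {f g h : a ⟶ b} → f ⇒ g → g ⇒ h → f ⇒ h
    _◃_ : ∀ {a b c} (f : a ⟶ b) {g h : b ⟶ c} → g ⇒ h → (f · g) ⇒ (f · h)
    _▹_ : ∀ {a b c} {f g : a ⟶ b} → f ⇒ g → (h : b ⟶ c) → (f · h) ⇒ (g · h)
    lunitor    : ∀ {a b} (f : a ⟶ b) → (id₁ · f) ⇒ f
    linvunitor : ∀ {a b} (f : a ⟶ b) → f ⇒ (id₁ · f)
    runitor    : ∀ {a b} (f : a ⟶ b) → (f · id₁) ⇒ f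
    rinvunitor : ∀ {a b} (f : a ⟶ b) → f ⇒ (f · id₁)
    lassociator : ∀ {a b c d} (f : a ⟶ b) (g : b ⟶ c) (h : c ⟶ d)
                  → (f · (g · h)) ⇒ ((f · g) · h)
    rassociator : ∀ {a b c d} (f : a ⟶ b) (g : b ⟶ c) (h : c ⟶ d)
                  → ((f · g) · h) ⇒ (f · (g · h))
    id2-left : ∀ {a b} {f g : a ⟶ b} (x : f ⇒ g) → id₂ • x ≡ x
    id2-right : ∀ {a b} {f g : a ⟶ b} (x : f ⇒ g) → x • id₂ ≡ x
    vassocr : ∀ {a b} {f g h k : a ⟶ b} (x : f ⇒ g) (y : g ⇒ h) (z : h ⇒ k)
              → x • (y • z) ≡ (x • y) • z
    lwhisker-id2 : ∀ {a b c} (f : a ⟶ b) (g : b ⟶ c) → (f ◃ id₂ {f = g}) ≡ id₂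
    id2-rwhisker : ∀ {a b c} (f : a ⟶ b) (g : b ⟶ c) → (id₂ {f = f} ▹ g) ≡ id₂
    lwhisker-vcomp : ∀ {a b c} (f : a ⟶ b) {g h k : b ⟶ c} (x : g ⇒ h) (y : h ⇒ k)
                     → (f ◃ x) • (f ◃ y) ≡ (f ◃ (x • y))
    rwhisker-vcomp : ∀ {a b c} {f g h : a ⟶ b} (i : b ⟶ c) (x : f ⇒ g) (y : g ⇒ h)
                     → (x ▹ i) • (y ▹ i) ≡ ((x • y) ▹ i)
    vcomp-lunitor : ∀ {a b} {f g : a ⟶ b} (x : f ⇒ g)
                    → (id₁ ◃ x) • lunitor g ≡ lunitor f • x
    vcomp-runitor : ∀ {a b} {f g : a ⟶ b} (x : f ⇒ g)
                    → (x ▹ id₁) • runitor g ≡ runitor f • x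
    lwhisker-lwhisker : ∀ {a b c d} (f : a ⟶ b) (g : b ⟶ c) {h i : c ⟶ d} (x : h ⇒ i)
                        → (f ◃ (g ◃ x)) • lassociator f g i ≡ lassociator f g h • ((f · g) ◃ x)
    rwhisker-lwhisker : ∀ {a b c d} (f : a ⟶ b) {g h : b ⟶ c} (i : c ⟶ d) (x : g ⇒ h)
                        → (f ◃ (x ▹ i)) • lassociator f h i ≡ lassociator f g i • ((f ◃ x) ▹ i)
    rwhisker-rwhisker : ∀ {a b c d} {f g : a ⟶ b} (h : b ⟶ c) (i : c ⟶ d) (x : f ⇒ g)
                        → lassociator f h i • ((x ▹ h) ▹ i) ≡ (x ▹ (h · i)) • lassociator g h i
    vcomp-whisker : ∀ {a b c} {f g : a ⟶ b} {h i : b ⟶ c} (x : f ⇒ g) (y : h ⇒ i)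
                    → (x ▹ h) • (g ◃ y) ≡ (f ◃ y) • (x ▹ i)
    lunitor-linvunitor : ∀ {a b} (f : a ⟶ b) → lunitor f • linvunitor f ≡ id₂
    linvunitor-lunitor : ∀ {a b} (f : a ⟶ b) → linvunitor f • lunitor f ≡ id₂
    runitor-rinvunitor : ∀ {a b} (f : a ⟶ b) → runitor f • rinvunitor f ≡ id₂
    rinvunitor-runitor : ∀ {a b} (f : a ⟶ b) → rinvunitor f • runitor f ≡ id₂
    lassociator-rassociator : ∀ {a b c d} (f : a ⟶ b) (g : b ⟶ c) (h : c ⟶ d)
                              → lassociator f g h • rassociator f g h ≡ id₂
    rassociator-lassociator : ∀ {a b c d} (f : a ⟶ b) (g : b ⟶ c) (h : c ⟶ d)
                              → rassociator f g h • lassociator f g h ≡ id₂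
    runitor-rwhisker : ∀ {a b c} (f : a ⟶ b) (g : b ⟶ c)
                       → lassociator f id₁ g • (runitor f ▹ g) ≡ (f ◃ lunitor g)
    lassociator-lassociator : ∀ {a b c d e} (f : a ⟶ b) (g : b ⟶ c) (h : c ⟶ d) (i : d ⟶ e)
      → (f ◃ lassociator g h i) • lassociator f (g · h) i • (lassociator f g h ▹ i)
        ≡ lassociator f g (h · i) • lassociator (f · g) h i

module _ {o h t} (B : Bicategory o h t) where
  open Bicategory B

  record IsInv {a b} {f g : a ⟶ b} (x : f ⇒ g) : Set t where
    field
      inv   : g ⇒ f
      inv-r : x • inv ≡ id₂
      inv-l : inv • x ≡ id₂

-- Displayed bicategories.  A displayed law lies over the corresponding
-- base law: transporting the displayed left-hand side along the base
-- law yields the displayed right-hand side.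

module _ {o h t} (B : Bicategory o h t) where
  open Bicategory B

  record DispBicat (o' h' t' : Level) : Set (o ⊔ h ⊔ t ⊔ lsuc (o' ⊔ h' ⊔ t')) where
    infixl 5 _•ᵈ_
    field
      Ob[_] : Ob → Set o'
      _⟶[_]_ : ∀ {a b} → Ob[ a ] → a ⟶ b → Ob[ b ] → Set h'
      _⇒[_]_ : ∀ {a b} {ā : Ob[ a ]} {b̄ : Ob[ b ]} {f g : a ⟶ b}
               → ā ⟶[ f ] b̄ → f ⇒ g → ā ⟶[ g ] b̄ → Set t'
      id₁ᵈ : ∀ {a} {ā : Ob[ a ]} → ā ⟶[ id₁ ] ā
      _·ᵈ_ : ∀ {a b c} {ā : Ob[ a ]} {b̄ : Ob[ b ]} {c̄ : Ob[ c ]} {f : a ⟶ b} {g : b ⟶ c}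
             → ā ⟶[ f ] b̄ → b̄ ⟶[ g ] c̄ → ā ⟶[ f · g ] c̄
      id₂ᵈ : ∀ {a b} {ā : Ob[ a ]} {b̄ : Ob[ b ]} {f : a ⟶ b} {ff : ā ⟶[ f ] b̄}
             → ff ⇒[ id₂ ] ff
      _•ᵈ_ : ∀ {a b} {ā : Ob[ a ]} {b̄ : Ob[ b ]} {f g h : a ⟶ b} {x : f ⇒ g} {y : g ⇒ h}
               {ff : ā ⟶[ f ] b̄} {gg : ā ⟶[ g ] b̄} {hh : ā ⟶[ h ] b̄}
             → ff ⇒[ x ] gg → gg ⇒[ y ] hh → ff ⇒[ x • y ] hh
      _◃ᵈ_ : ∀ {a b c} {ā : Ob[ a ]} {b̄ : Ob[ b ]} {c̄ : Ob[ c ]} {f : a ⟶ b} {g h : b ⟶ c}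
               {x : g ⇒ h} (ff : ā ⟶[ f ] b̄) {gg : b̄ ⟶[ g ] c̄} {hh : b̄ ⟶[ h ] c̄}
             → gg ⇒[ x ] hh → (ff ·ᵈ gg) ⇒[ f ◃ x ] (ff ·ᵈ hh)
      _▹ᵈ_ : ∀ {a b c} {ā : Ob[ a ]} {b̄ : Ob[ b ]} {c̄ : Ob[ c ]} {f g : a ⟶ b} {h : b ⟶ c}
               {x : f ⇒ g} {ff : ā ⟶[ f ] b̄} {gg : ā ⟶[ g ] b̄}
             → ff ⇒[ x ] gg → (hh : b̄ ⟶[ h ] c̄) → (ff ·ᵈ hh) ⇒[ x ▹ h ] (gg ·ᵈ hh)
      lunitorᵈ : ∀ {a b} {ā : Ob[ a ]} {b̄ : Ob[ b ]} {f : a ⟶ b} (ff : ā ⟶[ f ] b̄)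
                 → (id₁ᵈ ·ᵈ ff) ⇒[ lunitor f ] ff
      linvunitorᵈ : ∀ {a b} {ā : Ob[ a ]} {b̄ : Ob[ b ]} {f : a ⟶ b} (ff : ā ⟶[ f ] b̄)
                    → ff ⇒[ linvunitor f ] (id₁ᵈ ·ᵈ ff)
      runitorᵈ : ∀ {a b} {ā : Ob[ a ]} {b̄ : Ob[ b ]} {f : a ⟶ b} (ff : ā ⟶[ f ] b̄)
                 → (ff ·ᵈ id₁ᵈ) ⇒[ runitor f ] ff
      rinvunitorᵈ : ∀ {a b} {ā : Ob[ a ]} {b̄ : Ob[ b ]} {f : a ⟶ b} (ff : ā ⟶[ f ] b̄)
                    → ff ⇒[ rinvunitor f ] (ff ·ᵈ id₁ᵈ)
      lassociatorᵈ : ∀ {a b c d} {ā : Ob[ a ]} {b̄ : Ob[ b ]} {c̄ : Ob[ c ]} {d̄ : Ob[ d ]}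
                       {f : a ⟶ b} {g : b ⟶ c} {h : c ⟶ d}
                       (ff : ā ⟶[ f ] b̄) (gg : b̄ ⟶[ g ] c̄) (hh : c̄ ⟶[ h ] d̄)
                     → (ff ·ᵈ (gg ·ᵈ hh)) ⇒[ lassociator f g h ] ((ff ·ᵈ gg) ·ᵈ hh)
      rassociatorᵈ : ∀ {a b c d} {ā : Ob[ a ]} {b̄ : Ob[ b ]} {c̄ : Ob[ c ]} {d̄ : Ob[ d ]}
                       {f : a ⟶ b} {g : b ⟶ c} {h : c ⟶ d}
                       (ff : ā ⟶[ f ] b̄) (gg : b̄ ⟶[ g ] c̄) (hh : c̄ ⟶[ h ] d̄)
                     → ((ff ·ᵈ gg) ·ᵈ hh) ⇒[ rassociator f g h ] (ff ·ᵈ (gg ·ᵈ hh))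

    transp : ∀ {a b} {ā : Ob[ a ]} {b̄ : Ob[ b ]} {f g : a ⟶ b} {x y : f ⇒ g}
               {ff : ā ⟶[ f ] b̄} {gg : ā ⟶[ g ] b̄}
             → x ≡ y → ff ⇒[ x ] gg → ff ⇒[ y ] gg
    transp {ff = ff} {gg = gg} p xx = subst (λ z → ff ⇒[ z ] gg) p xx

    field
      id2-leftᵈ : ∀ {a b} {ā : Ob[ a ]} {b̄ : Ob[ b ]} {f g : a ⟶ b} {x : f ⇒ g}
                    {ff : ā ⟶[ f ] b̄} {gg : ā ⟶[ g ] b̄} (xx : ff ⇒[ x ] gg)
                  → transp (id2-left x) (id₂ᵈ •ᵈ xx) ≡ xx
      id2-rightᵈ : ∀ {a b} {ā : Ob[ a ]} {b̄ : Ob[ b ]} {f g : a ⟶ b} {x : f ⇒ g}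
                     {ff : ā ⟶[ f ] b̄} {gg : ā ⟶[ g ] b̄} (xx : ff ⇒[ x ] gg)
                   → transp (id2-right x) (xx •ᵈ id₂ᵈ) ≡ xx
      vassocrᵈ : ∀ {a b} {ā : Ob[ a ]} {b̄ : Ob[ b ]} {f g h k : a ⟶ b}
                   {x : f ⇒ g} {y : g ⇒ h} {z : h ⇒ k}
                   {ff : ā ⟶[ f ] b̄} {gg : ā ⟶[ g ] b̄} {hh : ā ⟶[ h ] b̄} {kk : ā ⟶[ k ] b̄}
                   (xx : ff ⇒[ x ] gg) (yy : gg ⇒[ y ] hh) (zz : hh ⇒[ z ] kk)
                 → transp (vassocr x y z) (xx •ᵈ (yy •ᵈ zz)) ≡ (xx •ᵈ yy) •ᵈ zz
      lwhisker-id2ᵈ : ∀ {a b c} {ā : Ob[ a ]} {b̄ : Ob[ b ]} {c̄ : Ob[ c ]} {f : a ⟶ b} {g : b ⟶ c}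
                        (ff : ā ⟶[ f ] b̄) (gg : b̄ ⟶[ g ] c̄)
                      → transp (lwhisker-id2 f g) (ff ◃ᵈ id₂ᵈ {ff = gg}) ≡ id₂ᵈ
      id2-rwhiskerᵈ : ∀ {a b c} {ā : Ob[ a ]} {b̄ : Ob[ b ]} {c̄ : Ob[ c ]} {f : a ⟶ b} {g : b ⟶ c}
                        (ff : ā ⟶[ f ] b̄) (gg : b̄ ⟶[ g ] c̄)
                      → transp (id2-rwhisker f g) (id₂ᵈ {ff = ff} ▹ᵈ gg) ≡ id₂ᵈ
      lwhisker-vcompᵈ : ∀ {a b c} {ā : Ob[ a ]} {b̄ : Ob[ b ]} {c̄ : Ob[ c ]} {f : a ⟶ b}
                          {g h k : b ⟶ c} {x : g ⇒ h} {y : h ⇒ k}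
                          (ff : ā ⟶[ f ] b̄) {gg : b̄ ⟶[ g ] c̄} {hh : b̄ ⟶[ h ] c̄} {kk : b̄ ⟶[ k ] c̄}
                          (xx : gg ⇒[ x ] hh) (yy : hh ⇒[ y ] kk)
                        → transp (lwhisker-vcomp f x y) ((ff ◃ᵈ xx) •ᵈ (ff ◃ᵈ yy)) ≡ (ff ◃ᵈ (xx •ᵈ yy))
      rwhisker-vcompᵈ : ∀ {a b c} {ā : Ob[ a ]} {b̄ : Ob[ b ]} {c̄ : Ob[ c ]} {f g h : a ⟶ b}
                          {i : b ⟶ c} {x : f ⇒ g} {y : g ⇒ h}
                          {ff : ā ⟶[ f ] b̄} {gg : ā ⟶[ g ] b̄} {hh : ā ⟶[ h ] b̄}
                          (ii : b̄ ⟶[ i ] c̄) (xx : ff ⇒[ x ] gg) (yy : gg ⇒[ y ] hh)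
                        → transp (rwhisker-vcomp i x y) ((xx ▹ᵈ ii) •ᵈ (yy ▹ᵈ ii)) ≡ ((xx •ᵈ yy) ▹ᵈ ii)
      vcomp-lunitorᵈ : ∀ {a b} {ā : Ob[ a ]} {b̄ : Ob[ b ]} {f g : a ⟶ b} {x : f ⇒ g}
                         {ff : ā ⟶[ f ] b̄} {gg : ā ⟶[ g ] b̄} (xx : ff ⇒[ x ] gg)
                       → transp (vcomp-lunitor x) ((id₁ᵈ ◃ᵈ xx) •ᵈ lunitorᵈ gg) ≡ lunitorᵈ ff •ᵈ xx
      vcomp-runitorᵈ : ∀ {a b} {ā : Ob[ a ]} {b̄ : Ob[ b ]} {f g : a ⟶ b} {x : f ⇒ g}
                         {ff : ā ⟶[ f ] b̄} {gg : ā ⟶[ g ] b̄} (xx : ff ⇒[ x ] gg)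
                       → transp (vcomp-runitor x) ((xx ▹ᵈ id₁ᵈ) •ᵈ runitorᵈ gg) ≡ runitorᵈ ff •ᵈ xx
      lwhisker-lwhiskerᵈ : ∀ {a b c d} {ā : Ob[ a ]} {b̄ : Ob[ b ]} {c̄ : Ob[ c ]} {d̄ : Ob[ d ]}
                             {f : a ⟶ b} {g : b ⟶ c} {h i : c ⟶ d} {x : h ⇒ i}
                             (ff : ā ⟶[ f ] b̄) (gg : b̄ ⟶[ g ] c̄) {hh : c̄ ⟶[ h ] d̄} {ii : c̄ ⟶[ i ] d̄}
                             (xx : hh ⇒[ x ] ii)
                           → transp (lwhisker-lwhisker f g x)
                                    ((ff ◃ᵈ (gg ◃ᵈ xx)) •ᵈ lassociatorᵈ ff gg ii)
                             ≡ lassociatorᵈ ff gg hh •ᵈ ((ff ·ᵈ gg) ◃ᵈ xx)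
      rwhisker-lwhiskerᵈ : ∀ {a b c d} {ā : Ob[ a ]} {b̄ : Ob[ b ]} {c̄ : Ob[ c ]} {d̄ : Ob[ d ]}
                             {f : a ⟶ b} {g h : b ⟶ c} {i : c ⟶ d} {x : g ⇒ h}
                             (ff : ā ⟶[ f ] b̄) {gg : b̄ ⟶[ g ] c̄} {hh : b̄ ⟶[ h ] c̄} (ii : c̄ ⟶[ i ] d̄)
                             (xx : gg ⇒[ x ] hh)
                           → transp (rwhisker-lwhisker f i x)
                                    ((ff ◃ᵈ (xx ▹ᵈ ii)) •ᵈ lassociatorᵈ ff hh ii)
                             ≡ lassociatorᵈ ff gg ii •ᵈ ((ff ◃ᵈ xx) ▹ᵈ ii)
      rwhisker-rwhiskerᵈ : ∀ {a b c d} {ā : Ob[ a ]} {b̄ : Ob[ b ]} {c̄ : Ob[ c ]} {d̄ : Ob[ d ]}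
                             {f g : a ⟶ b} {h : b ⟶ c} {i : c ⟶ d} {x : f ⇒ g}
                             {ff : ā ⟶[ f ] b̄} {gg : ā ⟶[ g ] b̄} (hh : b̄ ⟶[ h ] c̄) (ii : c̄ ⟶[ i ] d̄)
                             (xx : ff ⇒[ x ] gg)
                           → transp (rwhisker-rwhisker h i x)
                                    (lassociatorᵈ ff hh ii •ᵈ ((xx ▹ᵈ hh) ▹ᵈ ii))
                             ≡ (xx ▹ᵈ (hh ·ᵈ ii)) •ᵈ lassociatorᵈ gg hh ii
      vcomp-whiskerᵈ : ∀ {a b c} {ā : Ob[ a ]} {b̄ : Ob[ b ]} {c̄ : Ob[ c ]}
                         {f g : a ⟶ b} {h i : b ⟶ c} {x : f ⇒ g} {y : h ⇒ i}
                         {ff : ā ⟶[ f ] b̄} {gg : ā ⟶[ g ] b̄} {hh : b̄ ⟶[ h ] c̄} {ii : b̄ ⟶[ i ] c̄}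
                         (xx : ff ⇒[ x ] gg) (yy : hh ⇒[ y ] ii)
                       → transp (vcomp-whisker x y) ((xx ▹ᵈ hh) •ᵈ (gg ◃ᵈ yy))
                         ≡ (ff ◃ᵈ yy) •ᵈ (xx ▹ᵈ ii)
      lunitor-linvunitorᵈ : ∀ {a b} {ā : Ob[ a ]} {b̄ : Ob[ b ]} {f : a ⟶ b} (ff : ā ⟶[ f ] b̄)
                            → transp (lunitor-linvunitor f) (lunitorᵈ ff •ᵈ linvunitorᵈ ff) ≡ id₂ᵈ
      linvunitor-lunitorᵈ : ∀ {a b} {ā : Ob[ a ]} {b̄ : Ob[ b ]} {f : a ⟶ b} (ff : ā ⟶[ f ] b̄)
                            → transp (linvunitor-lunitor f) (linvunitorᵈ ff •ᵈ lunitorᵈ ff) ≡ id₂ᵈ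
      runitor-rinvunitorᵈ : ∀ {a b} {ā : Ob[ a ]} {b̄ : Ob[ b ]} {f : a ⟶ b} (ff : ā ⟶[ f ] b̄)
                            → transp (runitor-rinvunitor f) (runitorᵈ ff •ᵈ rinvunitorᵈ ff) ≡ id₂ᵈ
      rinvunitor-runitorᵈ : ∀ {a b} {ā : Ob[ a ]} {b̄ : Ob[ b ]} {f : a ⟶ b} (ff : ā ⟶[ f ] b̄)
                            → transp (rinvunitor-runitor f) (rinvunitorᵈ ff •ᵈ runitorᵈ ff) ≡ id₂ᵈ
      lassociator-rassociatorᵈ : ∀ {a b c d} {ā : Ob[ a ]} {b̄ : Ob[ b ]} {c̄ : Ob[ c ]} {d̄ : Ob[ d ]}
                                   {f : a ⟶ b} {g : b ⟶ c} {h : c ⟶ d}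
                                   (ff : ā ⟶[ f ] b̄) (gg : b̄ ⟶[ g ] c̄) (hh : c̄ ⟶[ h ] d̄)
                                 → transp (lassociator-rassociator f g h)
                                          (lassociatorᵈ ff gg hh •ᵈ rassociatorᵈ ff gg hh) ≡ id₂ᵈ
      rassociator-lassociatorᵈ : ∀ {a b c d} {ā : Ob[ a ]} {b̄ : Ob[ b ]} {c̄ : Ob[ c ]} {d̄ : Ob[ d ]}
                                   {f : a ⟶ b} {g : b ⟶ c} {h : c ⟶ d}
                                   (ff : ā ⟶[ f ] b̄) (gg : b̄ ⟶[ g ] c̄) (hh : c̄ ⟶[ h ] d̄)
                                 → transp (rassociator-lassociator f g h)
                                          (rassociatorᵈ ff gg hh •ᵈ lassociatorᵈ ff gg hh) ≡ id₂ᵈ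
      runitor-rwhiskerᵈ : ∀ {a b c} {ā : Ob[ a ]} {b̄ : Ob[ b ]} {c̄ : Ob[ c ]} {f : a ⟶ b} {g : b ⟶ c}
                            (ff : ā ⟶[ f ] b̄) (gg : b̄ ⟶[ g ] c̄)
                          → transp (runitor-rwhisker f g)
                                   (lassociatorᵈ ff id₁ᵈ gg •ᵈ (runitorᵈ ff ▹ᵈ gg))
                            ≡ (ff ◃ᵈ lunitorᵈ gg)
      lassociator-lassociatorᵈ : ∀ {a b c d e} {ā : Ob[ a ]} {b̄ : Ob[ b ]} {c̄ : Ob[ c ]} {d̄ : Ob[ d ]}
                                   {ē : Ob[ e ]} {f : a ⟶ b} {g : b ⟶ c} {h : c ⟶ d} {i : d ⟶ e}
                                   (ff : ā ⟶[ f ] b̄) (gg : b̄ ⟶[ g ] c̄) (hh : c̄ ⟶[ h ] d̄) (ii : d̄ ⟶[ i ] ē)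
                                 → transp (lassociator-lassociator f g h i)
                                          ((ff ◃ᵈ lassociatorᵈ gg hh ii) •ᵈ lassociatorᵈ ff (gg ·ᵈ hh) ii
                                            •ᵈ (lassociatorᵈ ff gg hh ▹ᵈ ii))
                                   ≡ lassociatorᵈ ff gg (hh ·ᵈ ii) •ᵈ lassociatorᵈ (ff ·ᵈ gg) hh ii

module _ {o h t o' h' t'} {B : Bicategory o h t} (D : DispBicat B o' h' t') where
  open Bicategory B
  open DispBicat D

  record DIsInv {a b} {ā : Ob[ a ]} {b̄ : Ob[ b ]} {f g : a ⟶ b} {x : f ⇒ g} (H : IsInv B x)
                {ff : ā ⟶[ f ] b̄} {gg : ā ⟶[ g ] b̄} (xx : ff ⇒[ x ] gg) : Set t' where
    field
      dinv   : gg ⇒[ IsInv.inv H ] ff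
      dinv-r : transp (IsInv.inv-r H) (xx •ᵈ dinv) ≡ id₂ᵈ
      dinv-l : transp (IsInv.inv-l H) (dinv •ᵈ xx) ≡ id₂ᵈ

  ∫ : Bicategory (o ⊔ o') (h ⊔ h') (t ⊔ t')
  ∫ = record
    { Ob = Σ Ob Ob[_]
    ; _⟶_ = λ a b → Σ (proj₁ a ⟶ proj₁ b) (λ f → proj₂ a ⟶[ f ] proj₂ b)
    ; _⇒_ = λ f g → Σ (proj₁ f ⇒ proj₁ g) (λ x → proj₂ f ⇒[ x ] proj₂ g)
    ; id₁ = id₁ , id₁ᵈ
    ; _·_ = λ f g → (proj₁ f · proj₁ g) , (proj₂ f ·ᵈ proj₂ g)
    ; id₂ = id₂ , id₂ᵈ
    ; _•_ = λ x y → (proj₁ x • proj₁ y) , (proj₂ x •ᵈ proj₂ y)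
    ; _◃_ = λ f x → (proj₁ f ◃ proj₁ x) , (proj₂ f ◃ᵈ proj₂ x)
    ; _▹_ = λ x f → (proj₁ x ▹ proj₁ f) , (proj₂ x ▹ᵈ proj₂ f)
    ; lunitor = λ f → lunitor (proj₁ f) , lunitorᵈ (proj₂ f)
    ; linvunitor = λ f → linvunitor (proj₁ f) , linvunitorᵈ (proj₂ f)
    ; runitor = λ f → runitor (proj₁ f) , runitorᵈ (proj₂ f)
    ; rinvunitor = λ f → rinvunitor (proj₁ f) , rinvunitorᵈ (proj₂ f)
    ; lassociator = λ f g h → lassociator (proj₁ f) (proj₁ g) (proj₁ h)
                              , lassociatorᵈ (proj₂ f) (proj₂ g) (proj₂ h)
    ; rassociator = λ f g h → rassociator (proj₁ f) (proj₁ g) (proj₁ h)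
                              , rassociatorᵈ (proj₂ f) (proj₂ g) (proj₂ h)
    ; id2-left = λ x → Σ-≡ (id2-left (proj₁ x)) (id2-leftᵈ (proj₂ x))
    ; id2-right = λ x → Σ-≡ (id2-right (proj₁ x)) (id2-rightᵈ (proj₂ x))
    ; vassocr = λ x y z → Σ-≡ (vassocr (proj₁ x) (proj₁ y) (proj₁ z))
                              (vassocrᵈ (proj₂ x) (proj₂ y) (proj₂ z))
    ; lwhisker-id2 = λ f g → Σ-≡ (lwhisker-id2 (proj₁ f) (proj₁ g)) (lwhisker-id2ᵈ (proj₂ f) (proj₂ g))
    ; id2-rwhisker = λ f g → Σ-≡ (id2-rwhisker (proj₁ f) (proj₁ g)) (id2-rwhiskerᵈ (proj₂ f) (proj₂ g))
    ; lwhisker-vcomp = λ f x y → Σ-≡ (lwhisker-vcomp (proj₁ f) (proj₁ x) (proj₁ y))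
                                     (lwhisker-vcompᵈ (proj₂ f) (proj₂ x) (proj₂ y))
    ; rwhisker-vcomp = λ i x y → Σ-≡ (rwhisker-vcomp (proj₁ i) (proj₁ x) (proj₁ y))
                                     (rwhisker-vcompᵈ (proj₂ i) (proj₂ x) (proj₂ y))
    ; vcomp-lunitor = λ x → Σ-≡ (vcomp-lunitor (proj₁ x)) (vcomp-lunitorᵈ (proj₂ x))
    ; vcomp-runitor = λ x → Σ-≡ (vcomp-runitor (proj₁ x)) (vcomp-runitorᵈ (proj₂ x))
    ; lwhisker-lwhisker = λ f g x → Σ-≡ (lwhisker-lwhisker (proj₁ f) (proj₁ g) (proj₁ x))
                                        (lwhisker-lwhiskerᵈ (proj₂ f) (proj₂ g) (proj₂ x))
    ; rwhisker-lwhisker = λ f i x → Σ-≡ (rwhisker-lwhisker (proj₁ f) (proj₁ i) (proj₁ x))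
                                        (rwhisker-lwhiskerᵈ (proj₂ f) (proj₂ i) (proj₂ x))
    ; rwhisker-rwhisker = λ h i x → Σ-≡ (rwhisker-rwhisker (proj₁ h) (proj₁ i) (proj₁ x))
                                        (rwhisker-rwhiskerᵈ (proj₂ h) (proj₂ i) (proj₂ x))
    ; vcomp-whisker = λ x y → Σ-≡ (vcomp-whisker (proj₁ x) (proj₁ y)) (vcomp-whiskerᵈ (proj₂ x) (proj₂ y))
    ; lunitor-linvunitor = λ f → Σ-≡ (lunitor-linvunitor (proj₁ f)) (lunitor-linvunitorᵈ (proj₂ f))
    ; linvunitor-lunitor = λ f → Σ-≡ (linvunitor-lunitor (proj₁ f)) (linvunitor-lunitorᵈ (proj₂ f))
    ; runitor-rinvunitor = λ f → Σ-≡ (runitor-rinvunitor (proj₁ f)) (runitor-rinvunitorᵈ (proj₂ f))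
    ; rinvunitor-runitor = λ f → Σ-≡ (rinvunitor-runitor (proj₁ f)) (rinvunitor-runitorᵈ (proj₂ f))
    ; lassociator-rassociator = λ f g h → Σ-≡ (lassociator-rassociator (proj₁ f) (proj₁ g) (proj₁ h))
                                              (lassociator-rassociatorᵈ (proj₂ f) (proj₂ g) (proj₂ h))
    ; rassociator-lassociator = λ f g h → Σ-≡ (rassociator-lassociator (proj₁ f) (proj₁ g) (proj₁ h))
                                              (rassociator-lassociatorᵈ (proj₂ f) (proj₂ g) (proj₂ h))
    ; runitor-rwhisker = λ f g → Σ-≡ (runitor-rwhisker (proj₁ f) (proj₁ g)) (runitor-rwhiskerᵈ (proj₂ f) (proj₂ g))
    ; lassociator-lassociator = λ f g h i →
        Σ-≡ (lassociator-lassociator (proj₁ f) (proj₁ g) (proj₁ h) (proj₁ i))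
            (lassociator-lassociatorᵈ (proj₂ f) (proj₂ g) (proj₂ h) (proj₂ i))
    }

  ∫-inv : ∀ {a b} {ā : Ob[ a ]} {b̄ : Ob[ b ]} {f g : a ⟶ b} {x : f ⇒ g} {H : IsInv B x}
            {ff : ā ⟶[ f ] b̄} {gg : ā ⟶[ g ] b̄} {xx : ff ⇒[ x ] gg}
          → DIsInv H xx → IsInv ∫ {a , ā} {b , b̄} {f , ff} {g , gg} (x , xx)
  ∫-inv {H = H} Hd = record
    { inv = IsInv.inv H , DIsInv.dinv Hd
    ; inv-r = Σ-≡ (IsInv.inv-r H) (DIsInv.dinv-r Hd)
    ; inv-l = Σ-≡ (IsInv.inv-l H) (DIsInv.dinv-l Hd)
    }

module _ {o₁ h₁ t₁ o₂ h₂ t₂} (B : Bicategory o₁ h₁ t₁) (C : Bicategory o₂ h₂ t₂) where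
  private module B = Bicategory B
  open Bicategory C

  record PsfData : Set (o₁ ⊔ h₁ ⊔ t₁ ⊔ o₂ ⊔ h₂ ⊔ t₂) where
    field
      F₀ : B.Ob → Ob
      F₁ : ∀ {a b} → a B.⟶ b → F₀ a ⟶ F₀ b
      F₂ : ∀ {a b} {f g : a B.⟶ b} → f B.⇒ g → F₁ f ⇒ F₁ g
      Fid : ∀ (a : B.Ob) → id₁ ⇒ F₁ (B.id₁ {a})
      Fcomp : ∀ {a b c} (f : a B.⟶ b) (g : b B.⟶ c) → (F₁ f · F₁ g) ⇒ F₁ (f B.· g)

  record IsPsfunctor (F : PsfData) : Set (o₁ ⊔ h₁ ⊔ t₁ ⊔ o₂ ⊔ h₂ ⊔ t₂) where
    open PsfData F
    field
      psf-id2 : ∀ {a b} (f : a B.⟶ b) → F₂ (B.id₂ {f = f}) ≡ id₂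
      psf-vcomp : ∀ {a b} {f g h : a B.⟶ b} (x : f B.⇒ g) (y : g B.⇒ h)
                  → F₂ (x B.• y) ≡ F₂ x • F₂ y
      psf-lunitor : ∀ {a b} (f : a B.⟶ b)
                    → lunitor (F₁ f) ≡ (Fid a ▹ F₁ f) • Fcomp B.id₁ f • F₂ (B.lunitor f)
      psf-runitor : ∀ {a b} (f : a B.⟶ b)
                    → runitor (F₁ f) ≡ (F₁ f ◃ Fid b) • Fcomp f B.id₁ • F₂ (B.runitor f)
      psf-lassociator : ∀ {a b c d} (f : a B.⟶ b) (g : b B.⟶ c) (h : c B.⟶ d)
                        → (F₁ f ◃ Fcomp g h) • Fcomp f (g B.· h) • F₂ (B.lassociator f g h)
                          ≡ lassociator (F₁ f) (F₁ g) (F₁ h) • (Fcomp f g ▹ F₁ h) • Fcomp (f B.· g) h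
      psf-lwhisker : ∀ {a b c} (f : a B.⟶ b) {g₁ g₂ : b B.⟶ c} (x : g₁ B.⇒ g₂)
                     → Fcomp f g₁ • F₂ (f B.◃ x) ≡ (F₁ f ◃ F₂ x) • Fcomp f g₂
      psf-rwhisker : ∀ {a b c} {f₁ f₂ : a B.⟶ b} (g : b B.⟶ c) (x : f₁ B.⇒ f₂)
                     → Fcomp f₁ g • F₂ (x B.▹ g) ≡ (F₂ x ▹ F₁ g) • Fcomp f₂ g
      Fid-inv : ∀ a → IsInv C (Fid a)
      Fcomp-inv : ∀ {a b c} (f : a B.⟶ b) (g : b B.⟶ c) → IsInv C (Fcomp f g)

  record Psfunctor : Set (o₁ ⊔ h₁ ⊔ t₁ ⊔ o₂ ⊔ h₂ ⊔ t₂) where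
    field
      dat  : PsfData
      laws : IsPsfunctor dat
    open PsfData dat public
    open IsPsfunctor laws public

idP : ∀ {o h t} (B : Bicategory o h t) → PsfData B B
idP B = record
  { F₀ = λ a → a ; F₁ = λ f → f ; F₂ = λ x → x
  ; Fid = λ a → id₂ ; Fcomp = λ f g → id₂ }
  where open Bicategory B

module _ {o₁ h₁ t₁ o₂ h₂ t₂ o₃ h₃ t₃}
         {A : Bicategory o₁ h₁ t₁} {B : Bicategory o₂ h₂ t₂} {C : Bicategory o₃ h₃ t₃} where
  open Bicategory C

  _⊙_ : PsfData A B → PsfData B C → PsfData A C
  F ⊙ G = record
    { F₀ = λ a → G.F₀ (F.F₀ a)
    ; F₁ = λ f → G.F₁ (F.F₁ f)
    ; F₂ = λ x → G.F₂ (F.F₂ x)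
    ; Fid = λ a → G.Fid (F.F₀ a) • G.F₂ (F.Fid a)
    ; Fcomp = λ f g → G.Fcomp (F.F₁ f) (F.F₁ g) • G.F₂ (F.Fcomp f g)
    }
    where module F = PsfData F
          module G = PsfData G

module _ {o₁ h₁ t₁ o₂ h₂ t₂} {B : Bicategory o₁ h₁ t₁} {C : Bicategory o₂ h₂ t₂} where
  private module B = Bicategory B
  open Bicategory C

  module _ (F G : PsfData B C) where
    private module F = PsfData F
    private module G = PsfData G

    record PreTrans : Set (o₁ ⊔ h₁ ⊔ h₂ ⊔ t₂) where
      field
        η₀ : ∀ a → F.F₀ a ⟶ G.F₀ a
        η₁ : ∀ {a b} (f : a B.⟶ b) → (η₀ a · G.F₁ f) ⇒ (F.F₁ f · η₀ b)

    record IsPsTrans (σ : PreTrans) : Set (o₁ ⊔ h₁ ⊔ t₁ ⊔ h₂ ⊔ t₂) where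
      open PreTrans σ
      field
        pst-nat : ∀ {a b} {f g : a B.⟶ b} (x : f B.⇒ g)
                  → (η₀ a ◃ G.F₂ x) • η₁ g ≡ η₁ f • (F.F₂ x ▹ η₀ b)
        pst-id : ∀ a → (η₀ a ◃ G.Fid a) • η₁ (B.id₁ {a})
                       ≡ runitor (η₀ a) • linvunitor (η₀ a) • (F.Fid a ▹ η₀ a)
        pst-comp : ∀ {a b c} (f : a B.⟶ b) (g : b B.⟶ c)
                   → (η₀ a ◃ G.Fcomp f g) • η₁ (f B.· g)
                     ≡ lassociator (η₀ a) (G.F₁ f) (G.F₁ g)
                       • (η₁ f ▹ G.F₁ g)
                       • rassociator (F.F₁ f) (η₀ b) (G.F₁ g)
                       • (F.F₁ f ◃ η₁ g)
                       • lassociator (F.F₁ f) (F.F₁ g) (η₀ c)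
                       • (F.Fcomp f g ▹ η₀ c)
        η₁-inv : ∀ {a b} (f : a B.⟶ b) → IsInv C (η₁ f)

    record PsTrans : Set (o₁ ⊔ h₁ ⊔ t₁ ⊔ h₂ ⊔ t₂) where
      field
        dat  : PreTrans
        laws : IsPsTrans dat
      open PreTrans dat public
      open IsPsTrans laws public

    module _ (σ τ : PreTrans) where
      private module σ = PreTrans σ
      private module τ = PreTrans τ

      record Modification : Set (o₁ ⊔ h₁ ⊔ t₂) where
        field
          m₀ : ∀ a → σ.η₀ a ⇒ τ.η₀ a
          m-law : ∀ {a b} (f : a B.⟶ b)
                  → (m₀ a ▹ G.F₁ f) • τ.η₁ f ≡ σ.η₁ f • (F.F₁ f ◃ m₀ b)

    record InvModification (σ τ : PreTrans) : Set (o₁ ⊔ h₁ ⊔ t₂) where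
      field
        mod : Modification σ τ
        inv : Modification τ σ
        inv-r : ∀ a → Modification.m₀ mod a • Modification.m₀ inv a ≡ id₂
        inv-l : ∀ a → Modification.m₀ inv a • Modification.m₀ mod a ≡ id₂

  idT : (F : PsfData B C) → PreTrans F F
  idT F = record { η₀ = λ a → id₁ ; η₁ = λ f → lunitor (PsfData.F₁ F f) • rinvunitor (PsfData.F₁ F f) }

  λT : (F : PsfData B C) → PreTrans (idP B ⊙ F) F
  λT F = record { η₀ = λ a → id₁ ; η₁ = λ f → lunitor (PsfData.F₁ F f) • rinvunitor (PsfData.F₁ F f) }

  λ⁻¹T : (F : PsfData B C) → PreTrans F (idP B ⊙ F)
  λ⁻¹T F = record { η₀ = λ a → id₁ ; η₁ = λ f → lunitor (PsfData.F₁ F f) • rinvunitor (PsfData.F₁ F f) }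

  ρT : (F : PsfData B C) → PreTrans (F ⊙ idP C) F
  ρT F = record { η₀ = λ a → id₁ ; η₁ = λ f → lunitor (PsfData.F₁ F f) • rinvunitor (PsfData.F₁ F f) }

  ρ⁻¹T : (F : PsfData B C) → PreTrans F (F ⊙ idP C)
  ρ⁻¹T F = record { η₀ = λ a → id₁ ; η₁ = λ f → lunitor (PsfData.F₁ F f) • rinvunitor (PsfData.F₁ F f) }

  infixl 5 _∙T_
  _∙T_ : {F G H : PsfData B C} → PreTrans F G → PreTrans G H → PreTrans F H
  _∙T_ {F} {G} {H} σ τ = record
    { η₀ = λ a → σ.η₀ a · τ.η₀ a
    ; η₁ = λ {a} {b} f → rassociator (σ.η₀ a) (τ.η₀ a) (H.F₁ f)
                         • (σ.η₀ a ◃ τ.η₁ f)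
                         • lassociator (σ.η₀ a) (G.F₁ f) (τ.η₀ b)
                         • (σ.η₁ f ▹ τ.η₀ b)
                         • rassociator (F.F₁ f) (σ.η₀ b) (τ.η₀ b)
    }
    where module σ = PreTrans σ
          module τ = PreTrans τ
          module F = PsfData F
          module G = PsfData G
          module H = PsfData H

module _ {o₁ h₁ t₁ o₂ h₂ t₂ o₃ h₃ t₃ o₄ h₄ t₄}
         {A : Bicategory o₁ h₁ t₁} {B : Bicategory o₂ h₂ t₂} {C : Bicategory o₃ h₃ t₃}
         {D : Bicategory o₄ h₄ t₄} where
  open Bicategory D

  αT : (F : PsfData A B) (G : PsfData B C) (H : PsfData C D) → PreTrans (F ⊙ (G ⊙ H)) ((F ⊙ G) ⊙ H)
  αT F G H = record { η₀ = λ a → id₁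
                    ; η₁ = λ f → lunitor (PsfData.F₁ (F ⊙ (G ⊙ H)) f) • rinvunitor (PsfData.F₁ (F ⊙ (G ⊙ H)) f) }

  α⁻¹T : (F : PsfData A B) (G : PsfData B C) (H : PsfData C D) → PreTrans ((F ⊙ G) ⊙ H) (F ⊙ (G ⊙ H))
  α⁻¹T F G H = record { η₀ = λ a → id₁
                      ; η₁ = λ f → lunitor (PsfData.F₁ (F ⊙ (G ⊙ H)) f) • rinvunitor (PsfData.F₁ (F ⊙ (G ⊙ H)) f) }

module _ {o₁ h₁ t₁ o₂ h₂ t₂ o₃ h₃ t₃}
         {A : Bicategory o₁ h₁ t₁} {B : Bicategory o₂ h₂ t₂} {C : Bicategory o₃ h₃ t₃} where
  open Bicategory C

  _◁_ : (F : PsfData A B) {G H : PsfData B C} → PreTrans G H → PreTrans (F ⊙ G) (F ⊙ H)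
  F ◁ σ = record { η₀ = λ a → PreTrans.η₀ σ (PsfData.F₀ F a)
                 ; η₁ = λ f → PreTrans.η₁ σ (PsfData.F₁ F f) }

  _▷_ : {G H : PsfData A B} → PreTrans G H → (K : Psfunctor B C) → PreTrans (G ⊙ Psfunctor.dat K) (H ⊙ Psfunctor.dat K)
  _▷_ {G} {H} σ K = record
    { η₀ = λ a → K.F₁ (σ.η₀ a)
    ; η₁ = λ {a} {b} f → K.Fcomp (σ.η₀ a) (H.F₁ f) • K.F₂ (σ.η₁ f)
                         • IsInv.inv (K.Fcomp-inv (G.F₁ f) (σ.η₀ b))
    }
    where module σ = PreTrans σ
          module K = Psfunctor K
          module G = PsfData G
          module H = PsfData H

module _ {o₁ h₁ t₁ o₂ h₂ t₂} {B₁ : Bicategory o₁ h₁ t₁} {B₂ : Bicategory o₂ h₂ t₂} where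

  record LeftBiadjoint (L : Psfunctor B₁ B₂) : Set (o₁ ⊔ h₁ ⊔ t₁ ⊔ o₂ ⊔ h₂ ⊔ t₂) where
    private module L = Psfunctor L
    field
      R  : Psfunctor B₂ B₁
    private module R = Psfunctor R
    field
      η  : PsTrans (idP B₁) (L.dat ⊙ R.dat)
      ε  : PsTrans (R.dat ⊙ L.dat) (idP B₂)
      τ₁ : InvModification R.dat R.dat
             (ρ⁻¹T R.dat ∙T (R.dat ◁ PsTrans.dat η) ∙T αT R.dat L.dat R.dat
                ∙T (PsTrans.dat ε ▷ R) ∙T λT R.dat)
             (idT R.dat)
      τ₂ : InvModification L.dat L.dat
             (λ⁻¹T L.dat ∙T (PsTrans.dat η ▷ L) ∙T α⁻¹T L.dat R.dat L.dat
                ∙T (L.dat ◁ PsTrans.dat ε) ∙T ρT L.dat)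
             (idT L.dat)

module _ {o₁ h₁ t₁ o₂ h₂ t₂ o₁' h₁' t₁' o₂' h₂' t₂'}
         {B : Bicategory o₁ h₁ t₁} {C : Bicategory o₂ h₂ t₂}
         (D : DispBicat B o₁' h₁' t₁') (E : DispBicat C o₂' h₂' t₂') where
  private module B = Bicategory B
  private module D = DispBicat D
  open Bicategory C
  open DispBicat E

  record DispPsfData (F : PsfData B C)
    : Set (o₁ ⊔ h₁ ⊔ t₁ ⊔ o₂ ⊔ h₂ ⊔ t₂ ⊔ o₁' ⊔ h₁' ⊔ t₁' ⊔ o₂' ⊔ h₂' ⊔ t₂') where
    open PsfData F
    field
      F₀ᵈ : ∀ {a} → D.Ob[ a ] → Ob[ F₀ a ]
      F₁ᵈ : ∀ {a b} {ā : D.Ob[ a ]} {b̄ : D.Ob[ b ]} {f : a B.⟶ b}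
            → ā D.⟶[ f ] b̄ → F₀ᵈ ā ⟶[ F₁ f ] F₀ᵈ b̄
      F₂ᵈ : ∀ {a b} {ā : D.Ob[ a ]} {b̄ : D.Ob[ b ]} {f g : a B.⟶ b} {x : f B.⇒ g}
              {ff : ā D.⟶[ f ] b̄} {gg : ā D.⟶[ g ] b̄}
            → ff D.⇒[ x ] gg → F₁ᵈ ff ⇒[ F₂ x ] F₁ᵈ gg
      Fidᵈ : ∀ {a} (ā : D.Ob[ a ]) → id₁ᵈ ⇒[ Fid a ] F₁ᵈ (D.id₁ᵈ {ā = ā})
      Fcompᵈ : ∀ {a b c} {ā : D.Ob[ a ]} {b̄ : D.Ob[ b ]} {c̄ : D.Ob[ c ]}
                 {f : a B.⟶ b} {g : b B.⟶ c} (ff : ā D.⟶[ f ] b̄) (gg : b̄ D.⟶[ g ] c̄)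
               → (F₁ᵈ ff ·ᵈ F₁ᵈ gg) ⇒[ Fcomp f g ] F₁ᵈ (ff D.·ᵈ gg)

  record IsDispPsfunctor {F : PsfData B C} (F̄ : DispPsfData F) (HF : IsPsfunctor B C F)
    : Set (o₁ ⊔ h₁ ⊔ t₁ ⊔ o₂ ⊔ h₂ ⊔ t₂ ⊔ o₁' ⊔ h₁' ⊔ t₁' ⊔ o₂' ⊔ h₂' ⊔ t₂') where
    open PsfData F
    open IsPsfunctor HF
    open DispPsfData F̄
    field
      psfᵈ-id2 : ∀ {a b} {ā : D.Ob[ a ]} {b̄ : D.Ob[ b ]} {f : a B.⟶ b} (ff : ā D.⟶[ f ] b̄)
                 → transp (psf-id2 f) (F₂ᵈ (D.id₂ᵈ {ff = ff})) ≡ id₂ᵈ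
      psfᵈ-vcomp : ∀ {a b} {ā : D.Ob[ a ]} {b̄ : D.Ob[ b ]} {f g h : a B.⟶ b}
                     {x : f B.⇒ g} {y : g B.⇒ h}
                     {ff : ā D.⟶[ f ] b̄} {gg : ā D.⟶[ g ] b̄} {hh : ā D.⟶[ h ] b̄}
                     (xx : ff D.⇒[ x ] gg) (yy : gg D.⇒[ y ] hh)
                   → transp (psf-vcomp x y) (F₂ᵈ (xx D.•ᵈ yy)) ≡ F₂ᵈ xx •ᵈ F₂ᵈ yy
      psfᵈ-lunitor : ∀ {a b} {ā : D.Ob[ a ]} {b̄ : D.Ob[ b ]} {f : a B.⟶ b} (ff : ā D.⟶[ f ] b̄)
                     → transp (psf-lunitor f) (lunitorᵈ (F₁ᵈ ff))
                       ≡ (Fidᵈ ā ▹ᵈ F₁ᵈ ff) •ᵈ Fcompᵈ D.id₁ᵈ ff •ᵈ F₂ᵈ (D.lunitorᵈ ff)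
      psfᵈ-runitor : ∀ {a b} {ā : D.Ob[ a ]} {b̄ : D.Ob[ b ]} {f : a B.⟶ b} (ff : ā D.⟶[ f ] b̄)
                     → transp (psf-runitor f) (runitorᵈ (F₁ᵈ ff))
                       ≡ (F₁ᵈ ff ◃ᵈ Fidᵈ b̄) •ᵈ Fcompᵈ ff D.id₁ᵈ •ᵈ F₂ᵈ (D.runitorᵈ ff)
      psfᵈ-lassociator : ∀ {a b c d} {ā : D.Ob[ a ]} {b̄ : D.Ob[ b ]} {c̄ : D.Ob[ c ]} {d̄ : D.Ob[ d ]}
                           {f : a B.⟶ b} {g : b B.⟶ c} {h : c B.⟶ d}
                           (ff : ā D.⟶[ f ] b̄) (gg : b̄ D.⟶[ g ] c̄) (hh : c̄ D.⟶[ h ] d̄)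
                         → transp (psf-lassociator f g h)
                                  ((F₁ᵈ ff ◃ᵈ Fcompᵈ gg hh) •ᵈ Fcompᵈ ff (gg D.·ᵈ hh)
                                     •ᵈ F₂ᵈ (D.lassociatorᵈ ff gg hh))
                           ≡ lassociatorᵈ (F₁ᵈ ff) (F₁ᵈ gg) (F₁ᵈ hh) •ᵈ (Fcompᵈ ff gg ▹ᵈ F₁ᵈ hh)
                               •ᵈ Fcompᵈ (ff D.·ᵈ gg) hh
      psfᵈ-lwhisker : ∀ {a b c} {ā : D.Ob[ a ]} {b̄ : D.Ob[ b ]} {c̄ : D.Ob[ c ]}
                        {f : a B.⟶ b} {g₁ g₂ : b B.⟶ c} {x : g₁ B.⇒ g₂}
                        (ff : ā D.⟶[ f ] b̄) {gg₁ : b̄ D.⟶[ g₁ ] c̄} {gg₂ : b̄ D.⟶[ g₂ ] c̄}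
                        (xx : gg₁ D.⇒[ x ] gg₂)
                      → transp (psf-lwhisker f x) (Fcompᵈ ff gg₁ •ᵈ F₂ᵈ (ff D.◃ᵈ xx))
                        ≡ (F₁ᵈ ff ◃ᵈ F₂ᵈ xx) •ᵈ Fcompᵈ ff gg₂
      psfᵈ-rwhisker : ∀ {a b c} {ā : D.Ob[ a ]} {b̄ : D.Ob[ b ]} {c̄ : D.Ob[ c ]}
                        {f₁ f₂ : a B.⟶ b} {g : b B.⟶ c} {x : f₁ B.⇒ f₂}
                        {ff₁ : ā D.⟶[ f₁ ] b̄} {ff₂ : ā D.⟶[ f₂ ] b̄} (gg : b̄ D.⟶[ g ] c̄)
                        (xx : ff₁ D.⇒[ x ] ff₂)
                      → transp (psf-rwhisker g x) (Fcompᵈ ff₁ gg •ᵈ F₂ᵈ (xx D.▹ᵈ gg))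
                        ≡ (F₂ᵈ xx ▹ᵈ F₁ᵈ gg) •ᵈ Fcompᵈ ff₂ gg
      Fid-invᵈ : ∀ {a} (ā : D.Ob[ a ]) → DIsInv E (Fid-inv a) (Fidᵈ ā)
      Fcomp-invᵈ : ∀ {a b c} {ā : D.Ob[ a ]} {b̄ : D.Ob[ b ]} {c̄ : D.Ob[ c ]}
                     {f : a B.⟶ b} {g : b B.⟶ c} (ff : ā D.⟶[ f ] b̄) (gg : b̄ D.⟶[ g ] c̄)
                   → DIsInv E (Fcomp-inv f g) (Fcompᵈ ff gg)

  record DispPsfunctor (F : Psfunctor B C)
    : Set (o₁ ⊔ h₁ ⊔ t₁ ⊔ o₂ ⊔ h₂ ⊔ t₂ ⊔ o₁' ⊔ h₁' ⊔ t₁' ⊔ o₂' ⊔ h₂' ⊔ t₂') where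
    field
      dat  : DispPsfData (Psfunctor.dat F)
      laws : IsDispPsfunctor dat (Psfunctor.laws F)
    open DispPsfData dat public
    open IsDispPsfunctor laws public

  ∫Psf : {F : Psfunctor B C} → DispPsfunctor F → Psfunctor (∫ D) (∫ E)
  ∫Psf {F} F̄ = record
    { dat = record
      { F₀ = λ a → F.F₀ (proj₁ a) , F̄.F₀ᵈ (proj₂ a)
      ; F₁ = λ f → F.F₁ (proj₁ f) , F̄.F₁ᵈ (proj₂ f)
      ; F₂ = λ x → F.F₂ (proj₁ x) , F̄.F₂ᵈ (proj₂ x)
      ; Fid = λ a → F.Fid (proj₁ a) , F̄.Fidᵈ (proj₂ a)
      ; Fcomp = λ f g → F.Fcomp (proj₁ f) (proj₁ g) , F̄.Fcompᵈ (proj₂ f) (proj₂ g)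
      }
    ; laws = record
      { psf-id2 = λ f → Σ-≡ (F.psf-id2 (proj₁ f)) (F̄.psfᵈ-id2 (proj₂ f))
      ; psf-vcomp = λ x y → Σ-≡ (F.psf-vcomp (proj₁ x) (proj₁ y)) (F̄.psfᵈ-vcomp (proj₂ x) (proj₂ y))
      ; psf-lunitor = λ f → Σ-≡ (F.psf-lunitor (proj₁ f)) (F̄.psfᵈ-lunitor (proj₂ f))
      ; psf-runitor = λ f → Σ-≡ (F.psf-runitor (proj₁ f)) (F̄.psfᵈ-runitor (proj₂ f))
      ; psf-lassociator = λ f g h → Σ-≡ (F.psf-lassociator (proj₁ f) (proj₁ g) (proj₁ h))
                                        (F̄.psfᵈ-lassociator (proj₂ f) (proj₂ g) (proj₂ h))
      ; psf-lwhisker = λ f x → Σ-≡ (F.psf-lwhisker (proj₁ f) (proj₁ x)) (F̄.psfᵈ-lwhisker (proj₂ f) (proj₂ x))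
      ; psf-rwhisker = λ g x → Σ-≡ (F.psf-rwhisker (proj₁ g) (proj₁ x)) (F̄.psfᵈ-rwhisker (proj₂ g) (proj₂ x))
      ; Fid-inv = λ a → ∫-inv E (F̄.Fid-invᵈ (proj₂ a))
      ; Fcomp-inv = λ f g → ∫-inv E (F̄.Fcomp-invᵈ (proj₂ f) (proj₂ g))
      }
    }
    where module F = Psfunctor F
          module F̄ = DispPsfunctor F̄

idPᵈ : ∀ {o h t o' h' t'} {B : Bicategory o h t} (D : DispBicat B o' h' t') → DispPsfData D D (idP B)
idPᵈ D = record
  { F₀ᵈ = λ ā → ā ; F₁ᵈ = λ ff → ff ; F₂ᵈ = λ xx → xx
  ; Fidᵈ = λ ā → id₂ᵈ ; Fcompᵈ = λ ff gg → id₂ᵈ }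
  where open DispBicat D

module _ {o₁ h₁ t₁ o₂ h₂ t₂ o₃ h₃ t₃ o₁' h₁' t₁' o₂' h₂' t₂' o₃' h₃' t₃'}
         {A : Bicategory o₁ h₁ t₁} {B : Bicategory o₂ h₂ t₂} {C : Bicategory o₃ h₃ t₃}
         {DA : DispBicat A o₁' h₁' t₁'} {DB : DispBicat B o₂' h₂' t₂'} {DC : DispBicat C o₃' h₃' t₃'} where
  open DispBicat DC

  _⊙ᵈ_ : {F : PsfData A B} {G : PsfData B C} → DispPsfData DA DB F → DispPsfData DB DC G
         → DispPsfData DA DC (F ⊙ G)
  F̄ ⊙ᵈ Ḡ = record
    { F₀ᵈ = λ ā → Ḡ.F₀ᵈ (F̄.F₀ᵈ ā)
    ; F₁ᵈ = λ ff → Ḡ.F₁ᵈ (F̄.F₁ᵈ ff)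
    ; F₂ᵈ = λ xx → Ḡ.F₂ᵈ (F̄.F₂ᵈ xx)
    ; Fidᵈ = λ ā → Ḡ.Fidᵈ (F̄.F₀ᵈ ā) •ᵈ Ḡ.F₂ᵈ (F̄.Fidᵈ ā)
    ; Fcompᵈ = λ ff gg → Ḡ.Fcompᵈ (F̄.F₁ᵈ ff) (F̄.F₁ᵈ gg) •ᵈ Ḡ.F₂ᵈ (F̄.Fcompᵈ ff gg)
    }
    where module F̄ = DispPsfData F̄
          module Ḡ = DispPsfData Ḡ

module _ {o₁ h₁ t₁ o₂ h₂ t₂ o₁' h₁' t₁' o₂' h₂' t₂'}
         {B : Bicategory o₁ h₁ t₁} {C : Bicategory o₂ h₂ t₂}
         {D : DispBicat B o₁' h₁' t₁'} {E : DispBicat C o₂' h₂' t₂'} where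
  private module B = Bicategory B
  private module D = DispBicat D
  open Bicategory C
  open DispBicat E

  module _ {F G : PsfData B C} (F̄ : DispPsfData D E F) (Ḡ : DispPsfData D E G) where
    private module F = PsfData F
    private module G = PsfData G
    private module F̄ = DispPsfData F̄
    private module Ḡ = DispPsfData Ḡ

    record DispPreTrans (σ : PreTrans F G)
      : Set (o₁ ⊔ h₁ ⊔ h₂ ⊔ t₂ ⊔ o₁' ⊔ h₁' ⊔ h₂' ⊔ t₂') where
      open PreTrans σ
      field
        η₀ᵈ : ∀ {a} (ā : D.Ob[ a ]) → F̄.F₀ᵈ ā ⟶[ η₀ a ] Ḡ.F₀ᵈ ā
        η₁ᵈ : ∀ {a b} {ā : D.Ob[ a ]} {b̄ : D.Ob[ b ]} {f : a B.⟶ b} (ff : ā D.⟶[ f ] b̄)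
              → (η₀ᵈ ā ·ᵈ Ḡ.F₁ᵈ ff) ⇒[ η₁ f ] (F̄.F₁ᵈ ff ·ᵈ η₀ᵈ b̄)

    record IsDispPsTrans {σ : PreTrans F G} (σ̄ : DispPreTrans σ) (Hσ : IsPsTrans F G σ)
      : Set (o₁ ⊔ h₁ ⊔ t₁ ⊔ h₂ ⊔ t₂ ⊔ o₁' ⊔ h₁' ⊔ t₁' ⊔ h₂' ⊔ t₂') where
      open PreTrans σ
      open IsPsTrans Hσ
      open DispPreTrans σ̄
      field
        pstᵈ-nat : ∀ {a b} {ā : D.Ob[ a ]} {b̄ : D.Ob[ b ]} {f g : a B.⟶ b} {x : f B.⇒ g}
                     {ff : ā D.⟶[ f ] b̄} {gg : ā D.⟶[ g ] b̄} (xx : ff D.⇒[ x ] gg)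
                   → transp (pst-nat x) ((η₀ᵈ ā ◃ᵈ Ḡ.F₂ᵈ xx) •ᵈ η₁ᵈ gg)
                     ≡ η₁ᵈ ff •ᵈ (F̄.F₂ᵈ xx ▹ᵈ η₀ᵈ b̄)
        pstᵈ-id : ∀ {a} (ā : D.Ob[ a ])
                  → transp (pst-id a) ((η₀ᵈ ā ◃ᵈ Ḡ.Fidᵈ ā) •ᵈ η₁ᵈ (D.id₁ᵈ {ā = ā}))
                    ≡ runitorᵈ (η₀ᵈ ā) •ᵈ linvunitorᵈ (η₀ᵈ ā) •ᵈ (F̄.Fidᵈ ā ▹ᵈ η₀ᵈ ā)
        pstᵈ-comp : ∀ {a b c} {ā : D.Ob[ a ]} {b̄ : D.Ob[ b ]} {c̄ : D.Ob[ c ]}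
                      {f : a B.⟶ b} {g : b B.⟶ c} (ff : ā D.⟶[ f ] b̄) (gg : b̄ D.⟶[ g ] c̄)
                    → transp (pst-comp f g) ((η₀ᵈ ā ◃ᵈ Ḡ.Fcompᵈ ff gg) •ᵈ η₁ᵈ (ff D.·ᵈ gg))
                      ≡ lassociatorᵈ (η₀ᵈ ā) (Ḡ.F₁ᵈ ff) (Ḡ.F₁ᵈ gg)
                        •ᵈ (η₁ᵈ ff ▹ᵈ Ḡ.F₁ᵈ gg)
                        •ᵈ rassociatorᵈ (F̄.F₁ᵈ ff) (η₀ᵈ b̄) (Ḡ.F₁ᵈ gg)
                        •ᵈ (F̄.F₁ᵈ ff ◃ᵈ η₁ᵈ gg)
                        •ᵈ lassociatorᵈ (F̄.F₁ᵈ ff) (F̄.F₁ᵈ gg) (η₀ᵈ c̄)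
                        •ᵈ (F̄.Fcompᵈ ff gg ▹ᵈ η₀ᵈ c̄)
        η₁-invᵈ : ∀ {a b} {ā : D.Ob[ a ]} {b̄ : D.Ob[ b ]} {f : a B.⟶ b} (ff : ā D.⟶[ f ] b̄)
                  → DIsInv E (η₁-inv f) (η₁ᵈ ff)

    record DispPsTrans (σ : PsTrans F G)
      : Set (o₁ ⊔ h₁ ⊔ t₁ ⊔ h₂ ⊔ t₂ ⊔ o₁' ⊔ h₁' ⊔ t₁' ⊔ h₂' ⊔ t₂') where
      field
        dat  : DispPreTrans (PsTrans.dat σ)
        laws : IsDispPsTrans dat (PsTrans.laws σ)
      open DispPreTrans dat public
      open IsDispPsTrans laws public

    module _ {σ τ : PreTrans F G} (σ̄ : DispPreTrans σ) (τ̄ : DispPreTrans τ) where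
      private module σ = PreTrans σ
      private module τ = PreTrans τ
      private module σ̄ = DispPreTrans σ̄
      private module τ̄ = DispPreTrans τ̄

      record DispModification (m : Modification F G σ τ)
        : Set (o₁ ⊔ h₁ ⊔ t₂ ⊔ o₁' ⊔ h₁' ⊔ t₂') where
        open Modification m
        field
          m₀ᵈ : ∀ {a} (ā : D.Ob[ a ]) → σ̄.η₀ᵈ ā ⇒[ m₀ a ] τ̄.η₀ᵈ ā
          m-lawᵈ : ∀ {a b} {ā : D.Ob[ a ]} {b̄ : D.Ob[ b ]} {f : a B.⟶ b} (ff : ā D.⟶[ f ] b̄)
                   → transp (m-law f) ((m₀ᵈ ā ▹ᵈ Ḡ.F₁ᵈ ff) •ᵈ τ̄.η₁ᵈ ff)
                     ≡ σ̄.η₁ᵈ ff •ᵈ (F̄.F₁ᵈ ff ◃ᵈ m₀ᵈ b̄)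

    record DispInvModification {σ τ : PreTrans F G} (σ̄ : DispPreTrans σ) (τ̄ : DispPreTrans τ)
                               (M : InvModification F G σ τ)
      : Set (o₁ ⊔ h₁ ⊔ t₂ ⊔ o₁' ⊔ h₁' ⊔ t₂') where
      open InvModification M
      field
        modᵈ : DispModification σ̄ τ̄ mod
        invᵈ : DispModification τ̄ σ̄ inv
        inv-rᵈ : ∀ {a} (ā : D.Ob[ a ])
                 → transp (inv-r a) (DispModification.m₀ᵈ modᵈ ā •ᵈ DispModification.m₀ᵈ invᵈ ā) ≡ id₂ᵈ
        inv-lᵈ : ∀ {a} (ā : D.Ob[ a ])
                 → transp (inv-l a) (DispModification.m₀ᵈ invᵈ ā •ᵈ DispModification.m₀ᵈ modᵈ ā) ≡ id₂ᵈ

  idTᵈ : {F : PsfData B C} (F̄ : DispPsfData D E F) → DispPreTrans F̄ F̄ (idT F)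
  idTᵈ F̄ = record { η₀ᵈ = λ ā → id₁ᵈ
                  ; η₁ᵈ = λ ff → lunitorᵈ (DispPsfData.F₁ᵈ F̄ ff) •ᵈ rinvunitorᵈ (DispPsfData.F₁ᵈ F̄ ff) }

  λTᵈ : {F : PsfData B C} (F̄ : DispPsfData D E F) → DispPreTrans (idPᵈ D ⊙ᵈ F̄) F̄ (λT F)
  λTᵈ F̄ = record { η₀ᵈ = λ ā → id₁ᵈ
                 ; η₁ᵈ = λ ff → lunitorᵈ (DispPsfData.F₁ᵈ F̄ ff) •ᵈ rinvunitorᵈ (DispPsfData.F₁ᵈ F̄ ff) }

  λ⁻¹Tᵈ : {F : PsfData B C} (F̄ : DispPsfData D E F) → DispPreTrans F̄ (idPᵈ D ⊙ᵈ F̄) (λ⁻¹T F)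
  λ⁻¹Tᵈ F̄ = record { η₀ᵈ = λ ā → id₁ᵈ
                   ; η₁ᵈ = λ ff → lunitorᵈ (DispPsfData.F₁ᵈ F̄ ff) •ᵈ rinvunitorᵈ (DispPsfData.F₁ᵈ F̄ ff) }

  ρTᵈ : {F : PsfData B C} (F̄ : DispPsfData D E F) → DispPreTrans (F̄ ⊙ᵈ idPᵈ E) F̄ (ρT F)
  ρTᵈ F̄ = record { η₀ᵈ = λ ā → id₁ᵈ
                 ; η₁ᵈ = λ ff → lunitorᵈ (DispPsfData.F₁ᵈ F̄ ff) •ᵈ rinvunitorᵈ (DispPsfData.F₁ᵈ F̄ ff) }

  ρ⁻¹Tᵈ : {F : PsfData B C} (F̄ : DispPsfData D E F) → DispPreTrans F̄ (F̄ ⊙ᵈ idPᵈ E) (ρ⁻¹T F)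
  ρ⁻¹Tᵈ F̄ = record { η₀ᵈ = λ ā → id₁ᵈ
                   ; η₁ᵈ = λ ff → lunitorᵈ (DispPsfData.F₁ᵈ F̄ ff) •ᵈ rinvunitorᵈ (DispPsfData.F₁ᵈ F̄ ff) }

  infixl 5 _∙Tᵈ_
  _∙Tᵈ_ : {F G H : PsfData B C} {F̄ : DispPsfData D E F} {Ḡ : DispPsfData D E G} {H̄ : DispPsfData D E H}
          {σ : PreTrans F G} {τ : PreTrans G H}
          → DispPreTrans F̄ Ḡ σ → DispPreTrans Ḡ H̄ τ → DispPreTrans F̄ H̄ (σ ∙T τ)
  _∙Tᵈ_ {F̄ = F̄} {Ḡ} {H̄} σ̄ τ̄ = record
    { η₀ᵈ = λ ā → σ̄.η₀ᵈ ā ·ᵈ τ̄.η₀ᵈ ā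
    ; η₁ᵈ = λ {a} {b} {ā} {b̄} ff → rassociatorᵈ (σ̄.η₀ᵈ ā) (τ̄.η₀ᵈ ā) (H̄.F₁ᵈ ff)
                                  •ᵈ (σ̄.η₀ᵈ ā ◃ᵈ τ̄.η₁ᵈ ff)
                                  •ᵈ lassociatorᵈ (σ̄.η₀ᵈ ā) (Ḡ.F₁ᵈ ff) (τ̄.η₀ᵈ b̄)
                                  •ᵈ (σ̄.η₁ᵈ ff ▹ᵈ τ̄.η₀ᵈ b̄)
                                  •ᵈ rassociatorᵈ (F̄.F₁ᵈ ff) (σ̄.η₀ᵈ b̄) (τ̄.η₀ᵈ b̄)
    }
    where module σ̄ = DispPreTrans σ̄
          module τ̄ = DispPreTrans τ̄
          module F̄ = DispPsfData F̄
          module Ḡ = DispPsfData Ḡ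
          module H̄ = DispPsfData H̄

module _ {o₁ h₁ t₁ o₂ h₂ t₂ o₃ h₃ t₃ o₄ h₄ t₄ o₁' h₁' t₁' o₂' h₂' t₂' o₃' h₃' t₃' o₄' h₄' t₄'}
         {A : Bicategory o₁ h₁ t₁} {B : Bicategory o₂ h₂ t₂} {C : Bicategory o₃ h₃ t₃}
         {D : Bicategory o₄ h₄ t₄}
         {DA : DispBicat A o₁' h₁' t₁'} {DB : DispBicat B o₂' h₂' t₂'} {DC : DispBicat C o₃' h₃' t₃'}
         {DD : DispBicat D o₄' h₄' t₄'} where
  open DispBicat DD

  αTᵈ : {F : PsfData A B} {G : PsfData B C} {H : PsfData C D}
        (F̄ : DispPsfData DA DB F) (Ḡ : DispPsfData DB DC G) (H̄ : DispPsfData DC DD H)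
        → DispPreTrans (F̄ ⊙ᵈ (Ḡ ⊙ᵈ H̄)) ((F̄ ⊙ᵈ Ḡ) ⊙ᵈ H̄) (αT F G H)
  αTᵈ F̄ Ḡ H̄ = record
    { η₀ᵈ = λ ā → id₁ᵈ
    ; η₁ᵈ = λ ff → lunitorᵈ (DispPsfData.F₁ᵈ (F̄ ⊙ᵈ (Ḡ ⊙ᵈ H̄)) ff)
                   •ᵈ rinvunitorᵈ (DispPsfData.F₁ᵈ (F̄ ⊙ᵈ (Ḡ ⊙ᵈ H̄)) ff) }

  α⁻¹Tᵈ : {F : PsfData A B} {G : PsfData B C} {H : PsfData C D}
          (F̄ : DispPsfData DA DB F) (Ḡ : DispPsfData DB DC G) (H̄ : DispPsfData DC DD H)
          → DispPreTrans ((F̄ ⊙ᵈ Ḡ) ⊙ᵈ H̄) (F̄ ⊙ᵈ (Ḡ ⊙ᵈ H̄)) (α⁻¹T F G H)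
  α⁻¹Tᵈ F̄ Ḡ H̄ = record
    { η₀ᵈ = λ ā → id₁ᵈ
    ; η₁ᵈ = λ ff → lunitorᵈ (DispPsfData.F₁ᵈ (F̄ ⊙ᵈ (Ḡ ⊙ᵈ H̄)) ff)
                   •ᵈ rinvunitorᵈ (DispPsfData.F₁ᵈ (F̄ ⊙ᵈ (Ḡ ⊙ᵈ H̄)) ff) }

module _ {o₁ h₁ t₁ o₂ h₂ t₂ o₃ h₃ t₃ o₁' h₁' t₁' o₂' h₂' t₂' o₃' h₃' t₃'}
         {A : Bicategory o₁ h₁ t₁} {B : Bicategory o₂ h₂ t₂} {C : Bicategory o₃ h₃ t₃}
         {DA : DispBicat A o₁' h₁' t₁'} {DB : DispBicat B o₂' h₂' t₂'} {DC : DispBicat C o₃' h₃' t₃'} where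
  open DispBicat DC

  _◁ᵈ_ : {F : PsfData A B} {G H : PsfData B C} {Ḡ : DispPsfData DB DC G} {H̄ : DispPsfData DB DC H}
         {σ : PreTrans G H} (F̄ : DispPsfData DA DB F)
         → DispPreTrans Ḡ H̄ σ → DispPreTrans (F̄ ⊙ᵈ Ḡ) (F̄ ⊙ᵈ H̄) (F ◁ σ)
  F̄ ◁ᵈ σ̄ = record { η₀ᵈ = λ ā → DispPreTrans.η₀ᵈ σ̄ (DispPsfData.F₀ᵈ F̄ ā)
                   ; η₁ᵈ = λ ff → DispPreTrans.η₁ᵈ σ̄ (DispPsfData.F₁ᵈ F̄ ff) }

  _▷ᵈ_ : {G H : PsfData A B} {Ḡ : DispPsfData DA DB G} {H̄ : DispPsfData DA DB H}
         {σ : PreTrans G H} {K : Psfunctor B C}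
         → DispPreTrans Ḡ H̄ σ → (K̄ : DispPsfunctor DB DC K)
         → DispPreTrans (Ḡ ⊙ᵈ DispPsfunctor.dat K̄) (H̄ ⊙ᵈ DispPsfunctor.dat K̄) (σ ▷ K)
  _▷ᵈ_ {Ḡ = Ḡ} {H̄} σ̄ K̄ = record
    { η₀ᵈ = λ ā → K̄.F₁ᵈ (σ̄.η₀ᵈ ā)
    ; η₁ᵈ = λ {a} {b} {ā} {b̄} ff → K̄.Fcompᵈ (σ̄.η₀ᵈ ā) (H̄.F₁ᵈ ff) •ᵈ K̄.F₂ᵈ (σ̄.η₁ᵈ ff)
                                  •ᵈ DIsInv.dinv (K̄.Fcomp-invᵈ (Ḡ.F₁ᵈ ff) (σ̄.η₀ᵈ b̄))
    }
    where module σ̄ = DispPreTrans σ̄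
          module K̄ = DispPsfunctor K̄
          module Ḡ = DispPsfData Ḡ
          module H̄ = DispPsfData H̄

module _ {o₁ h₁ t₁ o₂ h₂ t₂ o₁' h₁' t₁' o₂' h₂' t₂'}
         {B₁ : Bicategory o₁ h₁ t₁} {B₂ : Bicategory o₂ h₂ t₂}
         {D₁ : DispBicat B₁ o₁' h₁' t₁'} {D₂ : DispBicat B₂ o₂' h₂' t₂'} where

  record DispLeftBiadjoint {L : Psfunctor B₁ B₂} (adj : LeftBiadjoint L) (L̄ : DispPsfunctor D₁ D₂ L)
    : Set (o₁ ⊔ h₁ ⊔ t₁ ⊔ o₂ ⊔ h₂ ⊔ t₂ ⊔ o₁' ⊔ h₁' ⊔ t₁' ⊔ o₂' ⊔ h₂' ⊔ t₂') where
    private module adj = LeftBiadjoint adj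
    private module L̄ = DispPsfunctor L̄
    field
      R̄ : DispPsfunctor D₂ D₁ adj.R
    private module R̄ = DispPsfunctor R̄
    field
      η̄ : DispPsTrans (idPᵈ D₁) (L̄.dat ⊙ᵈ R̄.dat) adj.η
      ε̄ : DispPsTrans (R̄.dat ⊙ᵈ L̄.dat) (idPᵈ D₂) adj.ε
      τ̄₁ : DispInvModification R̄.dat R̄.dat
             (ρ⁻¹Tᵈ R̄.dat ∙Tᵈ (R̄.dat ◁ᵈ DispPsTrans.dat η̄) ∙Tᵈ αTᵈ R̄.dat L̄.dat R̄.dat
                ∙Tᵈ (DispPsTrans.dat ε̄ ▷ᵈ R̄) ∙Tᵈ λTᵈ R̄.dat)
             (idTᵈ R̄.dat)
             adj.τ₁
      τ̄₂ : DispInvModification L̄.dat L̄.dat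
             (λ⁻¹Tᵈ L̄.dat ∙Tᵈ (DispPsTrans.dat η̄ ▷ᵈ L̄) ∙Tᵈ α⁻¹Tᵈ L̄.dat R̄.dat L̄.dat
                ∙Tᵈ (L̄.dat ◁ᵈ DispPsTrans.dat ε̄) ∙Tᵈ ρTᵈ L̄.dat)
             (idTᵈ L̄.dat)
             adj.τ₂

-- Every datum of the biadjunction for ∫ L̄ is the pair of the base datum and
-- the displayed one lying over it, and every law is the pair (Σ-≡) of the base
-- law and the displayed law over it.  The total constructions commute on the
-- nose with identities, composition and whiskering of pseudotransformations
-- and with the unitor and associator transformations, so pairing the
-- modifications τ₁, τ₂ with τ̄₁, τ̄₂ already has the required types.
module Submission where

open import Defs
open import Data.Product using (_,_; proj₁; proj₂)

module _ {o₁ h₁ t₁ o₂ h₂ t₂ o₁' h₁' t₁' o₂' h₂' t₂'}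
         {B : Bicategory o₁ h₁ t₁} {C : Bicategory o₂ h₂ t₂}
         {D : DispBicat B o₁' h₁' t₁'} {E : DispBicat C o₂' h₂' t₂'} where

  ∫PsfData : {F : PsfData B C} → DispPsfData D E F → PsfData (∫ D) (∫ E)
  ∫PsfData {F} F̄ = record
    { F₀ = λ a → F.F₀ (proj₁ a) , F̄.F₀ᵈ (proj₂ a)
    ; F₁ = λ f → F.F₁ (proj₁ f) , F̄.F₁ᵈ (proj₂ f)
    ; F₂ = λ x → F.F₂ (proj₁ x) , F̄.F₂ᵈ (proj₂ x)
    ; Fid = λ a → F.Fid (proj₁ a) , F̄.Fidᵈ (proj₂ a)
    ; Fcomp = λ f g → F.Fcomp (proj₁ f) (proj₁ g) , F̄.Fcompᵈ (proj₂ f) (proj₂ g)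
    }
    where module F = PsfData F
          module F̄ = DispPsfData F̄

  module _ {F G : PsfData B C} {F̄ : DispPsfData D E F} {Ḡ : DispPsfData D E G} where

    ∫PreTrans : {σ : PreTrans F G} → DispPreTrans F̄ Ḡ σ → PreTrans (∫PsfData F̄) (∫PsfData Ḡ)
    ∫PreTrans {σ} σ̄ = record
      { η₀ = λ a → σ.η₀ (proj₁ a) , σ̄.η₀ᵈ (proj₂ a)
      ; η₁ = λ f → σ.η₁ (proj₁ f) , σ̄.η₁ᵈ (proj₂ f)
      }
      where module σ = PreTrans σ
            module σ̄ = DispPreTrans σ̄

    ∫PsTrans : {σ : PsTrans F G} → DispPsTrans F̄ Ḡ σ → PsTrans (∫PsfData F̄) (∫PsfData Ḡ)
    ∫PsTrans {σ} σ̄ = record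
      { dat = ∫PreTrans σ̄.dat
      ; laws = record
        { pst-nat = λ x → Σ-≡ (σ.pst-nat (proj₁ x)) (σ̄.pstᵈ-nat (proj₂ x))
        ; pst-id = λ a → Σ-≡ (σ.pst-id (proj₁ a)) (σ̄.pstᵈ-id (proj₂ a))
        ; pst-comp = λ f g → Σ-≡ (σ.pst-comp (proj₁ f) (proj₁ g)) (σ̄.pstᵈ-comp (proj₂ f) (proj₂ g))
        ; η₁-inv = λ f → ∫-inv E (σ̄.η₁-invᵈ (proj₂ f))
        }
      }
      where module σ = PsTrans σ
            module σ̄ = DispPsTrans σ̄

    ∫Modification : {σ τ : PreTrans F G} {σ̄ : DispPreTrans F̄ Ḡ σ} {τ̄ : DispPreTrans F̄ Ḡ τ}
                    {m : Modification F G σ τ} → DispModification F̄ Ḡ σ̄ τ̄ m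
                    → Modification (∫PsfData F̄) (∫PsfData Ḡ) (∫PreTrans σ̄) (∫PreTrans τ̄)
    ∫Modification {m = m} m̄ = record
      { m₀ = λ a → m.m₀ (proj₁ a) , m̄.m₀ᵈ (proj₂ a)
      ; m-law = λ f → Σ-≡ (m.m-law (proj₁ f)) (m̄.m-lawᵈ (proj₂ f))
      }
      where module m = Modification m
            module m̄ = DispModification m̄

    ∫InvModification : {σ τ : PreTrans F G} {σ̄ : DispPreTrans F̄ Ḡ σ} {τ̄ : DispPreTrans F̄ Ḡ τ}
                       {M : InvModification F G σ τ} → DispInvModification F̄ Ḡ σ̄ τ̄ M
                       → InvModification (∫PsfData F̄) (∫PsfData Ḡ) (∫PreTrans σ̄) (∫PreTrans τ̄)
    ∫InvModification {M = M} M̄ = record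
      { mod = ∫Modification M̄.modᵈ
      ; inv = ∫Modification M̄.invᵈ
      ; inv-r = λ a → Σ-≡ (M.inv-r (proj₁ a)) (M̄.inv-rᵈ (proj₂ a))
      ; inv-l = λ a → Σ-≡ (M.inv-l (proj₁ a)) (M̄.inv-lᵈ (proj₂ a))
      }
      where module M = InvModification M
            module M̄ = DispInvModification M̄

proposition5p8 : ∀ {o₁ h₁ t₁ o₂ h₂ t₂ o₁' h₁' t₁' o₂' h₂' t₂'}
                   {B₁ : Bicategory o₁ h₁ t₁} {B₂ : Bicategory o₂ h₂ t₂}
                   {D₁ : DispBicat B₁ o₁' h₁' t₁'} {D₂ : DispBicat B₂ o₂' h₂' t₂'}
                   {L : Psfunctor B₁ B₂} (adj : LeftBiadjoint L)
                   (L̄ : DispPsfunctor D₁ D₂ L)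
                 → DispLeftBiadjoint adj L̄
                 → LeftBiadjoint (∫Psf D₁ D₂ L̄)
proposition5p8 {D₁ = D₁} {D₂ = D₂} _ _ L̄-biadj =
  -- Binding ∫τ̄₁, ∫τ̄₂ first lets their types be inferred from τ̄₁, τ̄₂; checking
  -- ∫InvModification against the expected field type instead makes Agda unify
  -- through the composite pseudotransformations, which exhausts memory.
  let open DispLeftBiadjoint L̄-biadj
      ∫τ̄₁ = ∫InvModification τ̄₁
      ∫τ̄₂ = ∫InvModification τ̄₂
  in record
    { R = ∫Psf D₂ D₁ R̄
    ; η = ∫PsTrans η̄
    ; ε = ∫PsTrans ε̄
    ; τ₁ = ∫τ̄₁
    ; τ₂ = ∫τ̄₂
    }
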